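{- Consider any sequence of mergeable-tree operations on a heap-ordered forest, starting from the empty forest, consisting of $\mathit{insert}(v)$, $\mathit{merge}(v,w)$, $\mathit{root}(v)$, $\mathit{nca}(v,w)$, and deletions of leaves (no cuts and no parent queries), and simulate it on a forest of dynamic trees as follows: $\mathit{insert}(v)$ creates a new one-node dynamic tree $v$; a leaf deletion is ignored (does nothing); $\mathit{root}(v)$ returns $\mathit{treemin}(v)$; $\mathit{nca}(v,w)$ returns null if $\mathit{treemin}(v)\neq\mathit{treemin}(w)$, and otherwise does $\mathit{evert}(v)$ and returns $\mathit{pathmin}(w)$; $\mathit{merge}(v,w)$, if $\mathit{treemin}(v)\neq\mathit{treemin}(w)$, does $\mathit{evert}(v)$ and then $\mathit{link}(v,w)$, and otherwise does $\mathit{evert}(v)$, lets $u=\mathit{pathmin}(w)$, and if $u\notin\{v,w\}$ does $\mathit{cut}(u)$ and then $\mathit{link}(v,w)$. Then this simulation is correct: every $\mathit{root}$ and $\mathit{nca}$ query returns the root, respectively the nearest common ancestor (null if in different trees), in the current mergeable forest.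
   Context: A heap-ordered forest is a set of node-disjoint rooted trees whose nodes are distinct elements of a totally ordered set, with every non-root node greater than its parent. $\mathit{merge}(v,w)$: letting $P$ and $Q$ be the paths from $v$ and $w$ to the roots of their trees, every node $z\in P\cup Q$ gets as its new parent the largest node of $P\cup Q$ smaller than $z$ (no parent if none), while all other nodes keep their parents. Dynamic trees are rooted trees (not necessarily heap-ordered) on the same node set, supporting: $\mathit{treemin}(v)$, the minimum node in the tree containing $v$; $\mathit{pathmin}(v)$, the minimum node on the path from $v$ to the root of its tree; $\mathit{evert}(v)$, which makes $v$ the root of its tree by reversing every arc on the path from $v$ to the root; $\mathit{link}(v,w)$, which makes the root $v$ a child of $w$ (in a different tree); and $\mathit{cut}(u)$, which deletes the arc from $u$ to its parent. -}

module Defs where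

open import Data.Nat using (ℕ; zero; suc; _≡ᵇ_; _<ᵇ_; _⊓_; _⊔_)
open import Data.Bool using (Bool; true; false; if_then_else_; _∨_; not)
open import Data.Maybe using (Maybe; just; nothing)
open import Data.List using (List; []; _∷_; _++_; length; foldr; filterᵇ)
open import Data.List.Membership.Propositional using (_∈_; _∉_)
open import Data.List.Relation.Unary.All using (All)
open import Data.Product using (_×_; _,_)
open import Data.Unit using (⊤)
open import Relation.Binary.PropositionalEquality using (_≡_; _≢_)

-- Basic list helpers (nodes are natural numbers, ordered by the usual ≤)

elem : ℕ → List ℕ → Bool
elem z [] = false
elem z (x ∷ xs) = (z ≡ᵇ x) ∨ elem z xs

remove : ℕ → List ℕ → List ℕ
remove v = filterᵇ (λ x → not (x ≡ᵇ v))

lastOr : ℕ → List ℕ → ℕ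
lastOr d [] = d
lastOr d (x ∷ xs) = lastOr x xs

-- A forest of rooted trees: a finite node list and a parent function
-- (nothing = no parent, i.e. a root / not a node).

Parent : Set
Parent = ℕ → Maybe ℕ

record Forest : Set where
  constructor forest
  field
    nodes : List ℕ
    par   : Parent
open Forest public

emptyForest : Forest
emptyForest = forest [] (λ _ → nothing)

update : Parent → ℕ → Maybe ℕ → Parent
update p v m z = if z ≡ᵇ v then m else p z

-- path from v to the root, following parents; the fuel argument bounds the
-- length (the number of nodes is always enough for an acyclic forest).
pathF : ℕ → Parent → ℕ → List ℕ
pathF zero p v = v ∷ []
pathF (suc n) p v with p v
... | nothing = v ∷ []
... | just u  = v ∷ pathF n p u

path : Forest → ℕ → List ℕ
path F v = pathF (length (nodes F)) (par F) v

root : Forest → ℕ → ℕ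
root F v = lastOr v (path F v)

firstCommon : List ℕ → List ℕ → Maybe ℕ
firstCommon [] Q = nothing
firstCommon (x ∷ P) Q = if elem x Q then just x else firstCommon P Q

nca : Forest → ℕ → ℕ → Maybe ℕ
nca F v w = firstCommon (path F v) (path F w)

maxM : ℕ → Maybe ℕ → ℕ
maxM x nothing = x
maxM x (just y) = x ⊔ y

largestBelow : List ℕ → ℕ → Maybe ℕ
largestBelow [] z = nothing
largestBelow (x ∷ xs) z =
  if x <ᵇ z then just (maxM x (largestBelow xs z)) else largestBelow xs z

insertH : Forest → ℕ → Forest
insertH F v = forest (v ∷ nodes F) (update (par F) v nothing)

mergeH : Forest → ℕ → ℕ → Forest
mergeH F v w = forest (nodes F) newPar
  where
    L : List ℕ
    L = path F v ++ path F w
    newPar : Parent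
    newPar z = if elem z L then largestBelow L z else par F z

deleteH : Forest → ℕ → Forest
deleteH F v = forest (remove v (nodes F)) (update (par F) v nothing)

treemin : Forest → ℕ → ℕ
treemin D v = foldr _⊓_ v (filterᵇ (λ u → root D u ≡ᵇ root D v) (nodes D))

pathmin : Forest → ℕ → ℕ
pathmin D v = foldr _⊓_ v (path D v)

prevIn : List ℕ → ℕ → Maybe ℕ
prevIn [] z = nothing
prevIn (a ∷ []) z = nothing
prevIn (a ∷ b ∷ rest) z = if b ≡ᵇ z then just a else prevIn (b ∷ rest) z

evert : Forest → ℕ → Forest
evert D v = forest (nodes D) newPar
  where
    p : List ℕ
    p = path D v
    newPar : Parent
    newPar z = if elem z p then prevIn p z else par D z

link : Forest → ℕ → ℕ → Forest
link D v w = forest (nodes D) (update (par D) v (just w))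

cut : Forest → ℕ → Forest
cut D u = forest (nodes D) (update (par D) u nothing)

maketree : Forest → ℕ → Forest
maketree D v = forest (v ∷ nodes D) (update (par D) v nothing)

sameTree : Forest → ℕ → ℕ → Bool
sameTree D v w = treemin D v ≡ᵇ treemin D w

simMerge : Forest → ℕ → ℕ → Forest
simMerge D v w =
  if not (sameTree D v w)
  then link (evert D v) v w
  else (if elem u (v ∷ w ∷ []) then D₁ else link (cut D₁ u) v w)
  where
    D₁ : Forest
    D₁ = evert D v
    u : ℕ
    u = pathmin D₁ w

simNca : Forest → ℕ → ℕ → Forest × Maybe ℕ
simNca D v w =
  if not (sameTree D v w)
  then (D , nothing)
  else (evert D v , just (pathmin (evert D v) w))

data Op : Set where
  insert     : ℕ → Op
  merge      : ℕ → ℕ → Op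
  rootQ      : ℕ → Op
  ncaQ       : ℕ → ℕ → Op
  deleteLeaf : ℕ → Op

runH : Forest → List Op → List (Maybe ℕ)
runH F [] = []
runH F (insert v ∷ ops) = runH (insertH F v) ops
runH F (merge v w ∷ ops) = runH (mergeH F v w) ops
runH F (rootQ v ∷ ops) = just (root F v) ∷ runH F ops
runH F (ncaQ v w ∷ ops) = nca F v w ∷ runH F ops
runH F (deleteLeaf v ∷ ops) = runH (deleteH F v) ops

runD : Forest → List Op → List (Maybe ℕ)
runD D [] = []
runD D (insert v ∷ ops) = runD (maketree D v) ops
runD D (merge v w ∷ ops) = runD (simMerge D v w) ops
runD D (rootQ v ∷ ops) = just (treemin D v) ∷ runD D ops
runD D (ncaQ v w ∷ ops) with simNca D v w
... | (D' , a) = a ∷ runD D' ops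
runD D (deleteLeaf v ∷ ops) = runD D ops

-- validity of an operation sequence on the mergeable forest:
-- inserted nodes are new (never inserted before), operands are current
-- nodes, and only leaves are deleted.  `seen` = all nodes ever inserted.
Valid : List ℕ → Forest → List Op → Set
Valid seen F [] = ⊤
Valid seen F (insert v ∷ ops) = v ∉ seen × Valid (v ∷ seen) (insertH F v) ops
Valid seen F (merge v w ∷ ops) = v ∈ nodes F × w ∈ nodes F × Valid seen (mergeH F v w) ops
Valid seen F (rootQ v ∷ ops) = v ∈ nodes F × Valid seen F ops
Valid seen F (ncaQ v w ∷ ops) = v ∈ nodes F × w ∈ nodes F × Valid seen F ops
Valid seen F (deleteLeaf v ∷ ops) =
  v ∈ nodes F × All (λ u → par F u ≢ just v) (nodes F) × Valid seen (deleteH F v) ops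

-- Call x and y a-connected in a forest (Conn a) when a path of nodes ≥ a joins
-- them.  Throughout the simulation the mergeable forest and the dynamic forest
-- have the same a-connectivity for every threshold a, and the answers depend on
-- nothing else: in a heap-ordered forest the root of v is the least node of its
-- tree, and nca(v,w) is the largest c ≤ v for which v and w are c-connected
-- (MaxThreshold); after evert(v) in the dynamic forest, the minimum of the path
-- from w to v is that same largest threshold.
--
-- Every operation preserves the invariant.  Evert only reverses arcs.  Merging
-- v and w changes a-connectivity exactly by adding the edge v–w when a ≤ v, w,
-- because the nodes ≥ a of P ∪ Q become a single chain.  Link adds that edge;
-- in the same-tree case the cut arc from u = pathmin(w) does not matter, since
-- for a ≤ u the new edge v–w closes a cycle through it and for a > u it never
-- counted.  A deleted leaf keeps its parent in an auxiliary heap-ordered forest,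
-- just as it stays in the dynamic forest.

module Submission where

open import Defs
open import Data.Bool using (Bool; true; false; if_then_else_; not; T)
open import Data.Bool.Properties using (T-≡; ¬-not; T?; not-injective)
open import Data.Empty using (⊥; ⊥-elim)
open import Data.List using (List; []; _∷_; _++_; length; foldr; filterᵇ)
open import Data.List.Membership.Propositional using (_∈_; _∉_)
open import Data.List.Membership.Propositional.Properties
  using (∈-∃++; ∈-++⁻; ∈-++⁺ˡ; ∈-++⁺ʳ; ∈-filter⁺; ∈-filter⁻; foldr-selective)
open import Data.List.Properties using (length-++; foldr-preservesᵇ; foldr-preservesᵒ)
open import Data.List.Relation.Unary.All using (All)
open import Data.List.Relation.Unary.All.Properties using (¬Any⇒All¬)
import Data.List.Relation.Unary.All as All
open import Data.List.Relation.Unary.Any as Any using (here; there)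
open import Data.List.Relation.Unary.Unique.Propositional using (Unique; []; _∷_)
open import Data.Maybe using (Maybe; just; nothing)
open import Data.Maybe.Properties using (just-injective)
open import Data.Nat using (ℕ; zero; suc; _+_; _≤_; _<_; _≡ᵇ_; _<ᵇ_; _⊓_; _⊔_; z≤n; s≤s)
open import Data.Nat.Induction using (<-wellFounded)
open import Data.Nat.Properties
open import Data.List.Membership.DecPropositional _≟_ using (_∈?_)
open import Data.Product using (Σ; ∃; _×_; _,_; proj₁; proj₂)
open import Data.Sum using (_⊎_; inj₁; inj₂; [_,_])
open import Function using (_∘_; id; _⇔_; mk⇔; Equivalence)
open import Induction.WellFounded using (Acc; acc)
open import Relation.Binary.Construct.Closure.Equivalence as Eq using (EqClosure; _⋆)
open import Relation.Binary.Construct.Closure.ReflexiveTransitive as Star using (Star; ε; _◅_; _◅◅_)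
open import Relation.Binary.Construct.Closure.Symmetric using (SymClosure; fwd; bwd)
open import Relation.Nullary using (¬_; Dec; yes; no)
open import Relation.Binary.PropositionalEquality hiding ([_])

≡ᵇ-refl : ∀ n → (n ≡ᵇ n) ≡ true
≡ᵇ-refl n = Equivalence.to T-≡ (≡⇒≡ᵇ n n refl)

≡ᵇ-true⇒≡ : ∀ m n → (m ≡ᵇ n) ≡ true → m ≡ n
≡ᵇ-true⇒≡ m n e = ≡ᵇ⇒≡ m n (Equivalence.from T-≡ e)

≢⇒≡ᵇ-false : ∀ m n → m ≢ n → (m ≡ᵇ n) ≡ false
≢⇒≡ᵇ-false m n m≢n = ¬-not (m≢n ∘ ≡ᵇ-true⇒≡ m n)

≡ᵇ-false⇒≢ : ∀ {m n} → (m ≡ᵇ n) ≡ false → m ≢ n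
≡ᵇ-false⇒≢ {m} e refl with trans (sym (≡ᵇ-refl m)) e
... | ()

elem-true⇒∈ : ∀ z xs → elem z xs ≡ true → z ∈ xs
elem-true⇒∈ z [] ()
elem-true⇒∈ z (x ∷ xs) e with z ≡ᵇ x in eq
... | true  = here (≡ᵇ-true⇒≡ z x eq)
... | false = there (elem-true⇒∈ z xs e)

∈⇒elem-true : ∀ {z xs} → z ∈ xs → elem z xs ≡ true
∈⇒elem-true {z} (here refl) rewrite ≡ᵇ-refl z = refl
∈⇒elem-true {z} {x ∷ _} (there z∈xs) with z ≡ᵇ x
... | true  = refl
... | false = ∈⇒elem-true z∈xs

elem-false⇒∉ : ∀ z xs → elem z xs ≡ false → z ∉ xs
elem-false⇒∉ z xs e z∈xs with trans (sym (∈⇒elem-true z∈xs)) e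
... | ()

∉⇒elem-false : ∀ {z xs} → z ∉ xs → elem z xs ≡ false
∉⇒elem-false {z} {xs} z∉xs with elem z xs in eq
... | true  = ⊥-elim (z∉xs (elem-true⇒∈ z xs eq))
... | false = refl

∈-filterᵇ⁻ : ∀ (f : ℕ → Bool) xs {t} → t ∈ filterᵇ f xs → t ∈ xs × f t ≡ true
∈-filterᵇ⁻ f xs t∈ with ∈-filter⁻ (T? ∘ f) {xs = xs} t∈
... | t∈xs , ft = t∈xs , Equivalence.to T-≡ ft

∈-filterᵇ⁺ : ∀ (f : ℕ → Bool) xs {t} → t ∈ xs → f t ≡ true → t ∈ filterᵇ f xs
∈-filterᵇ⁺ f xs t∈xs ft = ∈-filter⁺ (T? ∘ f) {xs = xs} t∈xs (Equivalence.from T-≡ ft)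

∈-remove⁻ : ∀ x xs {z} → z ∈ remove x xs → z ∈ xs × z ≢ x
∈-remove⁻ x xs z∈ with ∈-filterᵇ⁻ (λ y → not (y ≡ᵇ x)) xs z∈
... | z∈xs , kept = z∈xs , ≡ᵇ-false⇒≢ (not-injective kept)

∈-remove⁺ : ∀ x xs {z} → z ∈ xs → z ≢ x → z ∈ remove x xs
∈-remove⁺ x xs {z} z∈xs z≢x =
  ∈-filterᵇ⁺ (λ y → not (y ≡ᵇ x)) xs z∈xs (cong not (≢⇒≡ᵇ-false z x z≢x))

Step : Parent → ℕ → ℕ → Set
Step p x y = p x ≡ just y

Anc : Parent → ℕ → ℕ → Set
Anc p = Star (Step p)

data Rooted (p : Parent) (z : ℕ) : Set where
  done : p z ≡ nothing → Rooted p z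
  next : ∀ {u} → p z ≡ just u → Rooted p u → Rooted p z

data IsPath (p : Parent) : ℕ → List ℕ → Set where
  end  : ∀ {z} → p z ≡ nothing → IsPath p z (z ∷ [])
  step : ∀ {z u xs} → p z ≡ just u → IsPath p u xs → IsPath p z (z ∷ xs)

Closed : Parent → List ℕ → Set
Closed p N = ∀ {x y} → p x ≡ just y → x ∈ N × y ∈ N

UpClosed : Parent → List ℕ → Set
UpClosed p N = ∀ {x y} → x ∈ N → p x ≡ just y → y ∈ N

closed⇒upClosed : ∀ {p N} → Closed p N → UpClosed p N
closed⇒upClosed cl _ e = proj₂ (cl e)

closed-∉ : ∀ {p N v} → Closed p N → v ∉ N → p v ≡ nothing
closed-∉ {p} {v = v} cl v∉N with p v in e
... | nothing = refl
... | just _  = ⊥-elim (v∉N (proj₁ (cl e)))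

module _ {p : Parent} where

  rooted⇒isPath : ∀ {z} → Rooted p z → ∃ (IsPath p z)
  rooted⇒isPath (done e)   = _ , end e
  rooted⇒isPath (next e r) = _ , step e (proj₂ (rooted⇒isPath r))

  isPath⇒rooted : ∀ {z xs} → IsPath p z xs → Rooted p z
  isPath⇒rooted (end e)    = done e
  isPath⇒rooted (step e c) = next e (isPath⇒rooted c)

  isPath-head : ∀ {z xs} → IsPath p z xs → z ∈ xs
  isPath-head (end _)    = here refl
  isPath-head (step _ _) = here refl

  isPath⇒anc : ∀ {z xs y} → IsPath p z xs → y ∈ xs → Anc p z y
  isPath⇒anc (end _)    (here refl) = ε
  isPath⇒anc (step _ _) (here refl) = ε
  isPath⇒anc (step e c) (there y∈)  = e ◅ isPath⇒anc c y∈

  anc⇒∈isPath : ∀ {z xs y} → IsPath p z xs → Anc p z y → y ∈ xs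
  anc⇒∈isPath c ε = isPath-head c
  anc⇒∈isPath (end e) (e′ ◅ _) with trans (sym e) e′
  ... | ()
  anc⇒∈isPath (step e c) (e′ ◅ a) with just-injective (trans (sym e) e′)
  ... | refl = there (anc⇒∈isPath c a)

  isPath-upClosed : ∀ {z xs} → IsPath p z xs → UpClosed p xs
  isPath-upClosed c x∈ e = anc⇒∈isPath c (isPath⇒anc c x∈ ◅◅ e ◅ ε)

  isPath-⊆ : ∀ {N z xs} → UpClosed p N → z ∈ N → IsPath p z xs → ∀ {y} → y ∈ xs → y ∈ N
  isPath-⊆ up z∈N (end _)    (here refl) = z∈N
  isPath-⊆ up z∈N (step _ _) (here refl) = z∈N
  isPath-⊆ up z∈N (step e c) (there y∈)  = isPath-⊆ up (up z∈N e) c y∈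

  rooted-acyclic : ∀ {u u₁} → Rooted p u → p u ≡ just u₁ → ¬ Anc p u₁ u
  rooted-acyclic (done e)   e′ _ with trans (sym e) e′
  ... | ()
  rooted-acyclic (next e r) e′ ε with just-injective (trans (sym e) e′)
  ... | refl = rooted-acyclic r e ε
  rooted-acyclic (next e r) e′ (e₁ ◅ a) with just-injective (trans (sym e) e′)
  ... | refl = rooted-acyclic r e₁ (a ◅◅ e ◅ ε)

  isPath-unique : ∀ {z xs} → IsPath p z xs → Unique xs
  isPath-unique (end _) = All.[] ∷ []
  isPath-unique (step e c) =
    ¬Any⇒All¬ _ (λ z∈ → rooted-acyclic (next e (isPath⇒rooted c)) e (isPath⇒anc c z∈))
    ∷ isPath-unique c

unique-⊆⇒length-≤ : ∀ {xs ys : List ℕ} → Unique xs → (∀ {y} → y ∈ xs → y ∈ ys) →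
                     length xs ≤ length ys
unique-⊆⇒length-≤ [] _ = z≤n
unique-⊆⇒length-≤ {x ∷ xs} (x≢xs ∷ u) xs⊆ys with ∈-∃++ (xs⊆ys (here refl))
... | pre , post , refl = begin
  suc (length xs)                 ≤⟨ s≤s (unique-⊆⇒length-≤ u xs⊆pre++post) ⟩
  suc (length (pre ++ post))      ≡⟨ cong suc (length-++ pre) ⟩
  suc (length pre + length post)  ≡⟨ sym (+-suc (length pre) (length post)) ⟩
  length pre + length (x ∷ post)  ≡⟨ sym (length-++ pre) ⟩
  length (pre ++ x ∷ post)        ∎
  where
  open ≤-Reasoning
  xs⊆pre++post : ∀ {y} → y ∈ xs → y ∈ pre ++ post
  xs⊆pre++post y∈xs with ∈-++⁻ pre (xs⊆ys (there y∈xs))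
  ... | inj₁ y∈pre          = ∈-++⁺ˡ y∈pre
  ... | inj₂ (here refl)    = ⊥-elim (All.lookup x≢xs y∈xs refl)
  ... | inj₂ (there y∈post) = ∈-++⁺ʳ pre y∈post

pathF-isPath : ∀ {p z xs} n → IsPath p z xs → length xs ≤ suc n → pathF n p z ≡ xs
pathF-isPath zero    (end _)           _         = refl
pathF-isPath (suc n) (end e)           _         rewrite e = refl
pathF-isPath zero    (step _ (end _))  (s≤s ())
pathF-isPath zero    (step _ (step _ _)) (s≤s ())
pathF-isPath (suc n) (step e c)        (s≤s len) rewrite e = cong (_ ∷_) (pathF-isPath n c len)

path-isPath : ∀ {F z xs} → Closed (par F) (nodes F) → IsPath (par F) z xs → path F z ≡ xs
path-isPath {F} cl (end e) = pathF-isPath (length (nodes F)) (end e) (s≤s z≤n)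
path-isPath {F} cl c@(step e _) = pathF-isPath (length (nodes F)) c
  (m≤n⇒m≤1+n (unique-⊆⇒length-≤ (isPath-unique c)
                                 (isPath-⊆ (closed⇒upClosed cl) (proj₁ (cl e)) c)))

Edge : ℕ → Parent → ℕ → ℕ → Set
Edge a p x y = p x ≡ just y × a ≤ x × a ≤ y

Conn : ℕ → Parent → ℕ → ℕ → Set
Conn a p = EqClosure (Edge a p)

module _ {a : ℕ} {p : Parent} where

  arc : ∀ {x y} → p x ≡ just y → a ≤ x → a ≤ y → Conn a p x y
  arc e a≤x a≤y = Eq.return (e , a≤x , a≤y)

  Conn-sym : ∀ {x y} → Conn a p x y → Conn a p y x
  Conn-sym = Eq.symmetric (Edge a p)

  Conn-transport : (Q : ℕ → Set) → (∀ {x y} → Edge a p x y → Q x ⇔ Q y) →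
                   ∀ {x y} → Conn a p x y → Q x → Q y
  Conn-transport Q Q-edge = Star.fold (λ x y → Q x → Q y) along id
    where
    along : ∀ {x y z} → SymClosure (Edge a p) x y → (Q y → Q z) → Q x → Q z
    along (fwd r) k = k ∘ Equivalence.to (Q-edge r)
    along (bwd r) k = k ∘ Equivalence.from (Q-edge r)

  isPath⇒Conn : ∀ {z xs y} → IsPath p z xs → (∀ {t} → t ∈ xs → a ≤ t) → y ∈ xs →
                Conn a p z y
  isPath⇒Conn (end _)    _    (here refl) = ε
  isPath⇒Conn (step _ _) _    (here refl) = ε
  isPath⇒Conn (step e c) a≤xs (there y∈)  =
    arc e (a≤xs (here refl)) (a≤xs (there (isPath-head c))) ◅◅ isPath⇒Conn c (a≤xs ∘ there) y∈

Conn-anti : ∀ {a b p x y} → a ≤ b → Conn b p x y → Conn a p x y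
Conn-anti a≤b = Eq.map (λ (e , b≤x , b≤y) → e , ≤-trans a≤b b≤x , ≤-trans a≤b b≤y)

anc⇒Conn₀ : ∀ {p x y} → Anc p x y → Conn 0 p x y
anc⇒Conn₀ ε       = ε
anc⇒Conn₀ (e ◅ a) = arc e z≤n z≤n ◅◅ anc⇒Conn₀ a

RootOf : Parent → ℕ → ℕ → Set
RootOf p z r = Anc p z r × p r ≡ nothing

module _ {p : Parent} where

  rootOf-unique : ∀ {z r s} → RootOf p z r → RootOf p z s → r ≡ s
  rootOf-unique {r = r} {s} (a , pr) (b , ps) = go a b
    where
    go : ∀ {z} → Anc p z r → Anc p z s → r ≡ s
    go ε ε = refl
    go ε (e ◅ _) with trans (sym pr) e
    ... | ()
    go (e ◅ _) ε with trans (sym ps) e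
    ... | ()
    go (e ◅ a) (e′ ◅ b) with just-injective (trans (sym e) e′)
    ... | refl = go a b

  rootOf-parent : ∀ {x y r} → p x ≡ just y → RootOf p x r ⇔ RootOf p y r
  rootOf-parent e = mk⇔ to (λ (a , pr) → e ◅ a , pr)
    where
    to : ∀ {r} → RootOf _ _ r → RootOf _ _ r
    to (ε , pr) with trans (sym e) pr
    ... | ()
    to (e′ ◅ a , pr) with just-injective (trans (sym e) e′)
    ... | refl = a , pr

  rootOf-Conn : ∀ {a x y r} → Conn a p x y → RootOf p x r → RootOf p y r
  rootOf-Conn {r = r} = Conn-transport (λ z → RootOf p z r) (rootOf-parent ∘ proj₁)

  isPath-rootOf : ∀ {z xs} → IsPath p z xs → RootOf p z (lastOr z xs)
  isPath-rootOf (end e) = ε , e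
  isPath-rootOf (step e c@(end _))    = Equivalence.from (rootOf-parent e) (isPath-rootOf c)
  isPath-rootOf (step e c@(step _ _)) = Equivalence.from (rootOf-parent e) (isPath-rootOf c)

foldr-⊓-≤ : ∀ d xs {t} → t ∈ xs → foldr _⊓_ d xs ≤ t
foldr-⊓-≤ d xs t∈xs = foldr-preservesᵒ (λ x y → [ m≤n⇒m⊓o≤n y , m≤n⇒o⊓m≤n x ]) d xs
  (inj₂ (Any.map (≤-reflexive ∘ sym) t∈xs))

≤-foldr-⊓ : ∀ {c} d xs → c ≤ d → (∀ {t} → t ∈ xs → c ≤ t) → c ≤ foldr _⊓_ d xs
≤-foldr-⊓ d xs c≤d c≤xs = foldr-preservesᵇ ⊓-glb c≤d (All.tabulate c≤xs)

foldr-⊓-∈ : ∀ x xs → foldr _⊓_ x (x ∷ xs) ∈ x ∷ xs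
foldr-⊓-∈ x xs with foldr-selective ⊓-sel x (x ∷ xs)
... | inj₁ min≡x  = subst (_∈ x ∷ xs) (sym min≡x) (here refl)
... | inj₂ min∈xs = min∈xs

isPath-foldr-⊓-∈ : ∀ {p z xs} → IsPath p z xs → foldr _⊓_ z xs ∈ xs
isPath-foldr-⊓-∈ (end _)    = foldr-⊓-∈ _ []
isPath-foldr-⊓-∈ (step _ _) = foldr-⊓-∈ _ _

AncestorsAbove : ℕ → Parent → ℕ → Set
AncestorsAbove a p x = ∀ {t} → Anc p x t → a ≤ t

HasAncestorAboveIn : ℕ → Parent → List ℕ → ℕ → Set
HasAncestorAboveIn a p S x = ∃ λ t → Anc p x t × t ∈ S × a ≤ t

module _ {a : ℕ} {p : Parent} where

  ancestorsAbove-Conn : ∀ {x y} → Conn a p x y → AncestorsAbove a p x → AncestorsAbove a p y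
  ancestorsAbove-Conn = Conn-transport (AncestorsAbove a p) step-⇔
    where
    step-⇔ : ∀ {x y} → Edge a p x y → AncestorsAbove a p x ⇔ AncestorsAbove a p y
    step-⇔ {x} {y} (e , a≤x , _) = mk⇔ (λ above {t} y↝t → above (e ◅ y↝t)) from
      where
      from : AncestorsAbove a p y → AncestorsAbove a p x
      from above ε = a≤x
      from above (e′ ◅ t) with just-injective (trans (sym e) e′)
      ... | refl = above t

  hasAncestorAboveIn-Conn : ∀ {S} → UpClosed p S →
                            ∀ {x y} → Conn a p x y →
                            HasAncestorAboveIn a p S x → HasAncestorAboveIn a p S y
  hasAncestorAboveIn-Conn {S} S-up = Conn-transport (HasAncestorAboveIn a p S) step-⇔
    where
    step-⇔ : ∀ {x y} → Edge a p x y → HasAncestorAboveIn a p S x ⇔ HasAncestorAboveIn a p S y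
    step-⇔ {x} {y} (e , _ , a≤y) =
      mk⇔ to (λ (t , y↝t , t∈S , a≤t) → t , e ◅ y↝t , t∈S , a≤t)
      where
      to : HasAncestorAboveIn a p S x → HasAncestorAboveIn a p S y
      to (t , ε , t∈S , _) = y , ε , S-up t∈S e , a≤y
      to (t , e′ ◅ u↝t , t∈S , a≤t) with just-injective (trans (sym e) e′)
      ... | refl = t , u↝t , t∈S , a≤t

MaxThreshold : Parent → ℕ → ℕ → ℕ → Set
MaxThreshold p v w c = c ≤ v × Conn c p v w × (∀ {a} → a ≤ v → Conn a p v w → a ≤ c)

maxThreshold-unique : ∀ {p q v w c m} →
  (∀ {a x y} → Conn a p x y → Conn a q x y) → (∀ {a x y} → Conn a q x y → Conn a p x y) →
  MaxThreshold p v w c → MaxThreshold q v w m → c ≡ m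
maxThreshold-unique p⇒q q⇒p (c≤v , v~w , c-max) (m≤v , v≈w , m-max) =
  ≤-antisym (m-max c≤v (p⇒q v~w)) (c-max m≤v (q⇒p v≈w))

pathmin-maxThreshold : ∀ {p v w ws} → p v ≡ nothing → IsPath p w ws → v ∈ ws →
                       MaxThreshold p v w (foldr _⊓_ w ws)
pathmin-maxThreshold {p} {v} {w} {ws} v-root c v∈ws =
  foldr-⊓-≤ w ws v∈ws , Conn-sym (isPath⇒Conn c (foldr-⊓-≤ w ws) v∈ws) , maximal
  where
  maximal : ∀ {a} → a ≤ v → Conn a p v w → a ≤ foldr _⊓_ w ws
  maximal {a} a≤v v~w = ≤-foldr-⊓ w ws (above ε) (above ∘ isPath⇒anc c)
    where
    v-above : AncestorsAbove a p v
    v-above ε = a≤v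
    v-above (e ◅ _) with trans (sym v-root) e
    ... | ()
    above : AncestorsAbove a p w
    above = ancestorsAbove-Conn v~w v-above

Heap : Parent → Set
Heap p = ∀ {x y} → p x ≡ just y → y < x

module _ {p : Parent} (heap : Heap p) where

  heap-rooted : ∀ z → Rooted p z
  heap-rooted z = go z (<-wellFounded z)
    where
    go : ∀ z → Acc _<_ z → Rooted p z
    go z (acc rs) with p z in eq
    ... | nothing = done eq
    ... | just u  = next eq (go u (rs (heap eq)))

  heap-isPath : ∀ z → ∃ (IsPath p z)
  heap-isPath z = rooted⇒isPath (heap-rooted z)

  anc-≤ : ∀ {x y} → Anc p x y → y ≤ x
  anc-≤ ε       = ≤-refl
  anc-≤ (e ◅ a) = ≤-trans (anc-≤ a) (<⇒≤ (heap e))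

  isPath-≤ : ∀ {z xs y} → IsPath p z xs → y ∈ xs → y ≤ z
  isPath-≤ c = anc-≤ ∘ isPath⇒anc c

  isPath⇒Conn-heap : ∀ {a z xs y} → IsPath p z xs → y ∈ xs → a ≤ y → Conn a p z y
  isPath⇒Conn-heap (end _)    (here refl) _   = ε
  isPath⇒Conn-heap (step _ _) (here refl) _   = ε
  isPath⇒Conn-heap (step e c) (there y∈)  a≤y =
    arc e (≤-trans a≤y (≤-trans (isPath-≤ c y∈) (<⇒≤ (heap e))))
          (≤-trans a≤y (isPath-≤ c y∈))
    ◅◅ isPath⇒Conn-heap c y∈ a≤y

  firstCommon-isPath : ∀ {z P Q t} → IsPath p z P → t ∈ P → t ∈ Q →
    ∃ λ c → firstCommon P Q ≡ just c × c ∈ P × c ∈ Q × (∀ {s} → s ∈ P → s ∈ Q → s ≤ c)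
  firstCommon-isPath {z} {Q = Q} c t∈P t∈Q with elem z Q in eq
  ... | true  = z , starts-common c , isPath-head c , elem-true⇒∈ z Q eq , λ s∈P _ → isPath-≤ c s∈P
    where
    starts-common : ∀ {P} → IsPath p z P → firstCommon P Q ≡ just z
    starts-common (end _)    rewrite eq = refl
    starts-common (step _ _) rewrite eq = refl
  firstCommon-isPath {z} {Q = Q} (end _)    (here refl) t∈Q | false = ⊥-elim (elem-false⇒∉ z Q eq t∈Q)
  firstCommon-isPath {z} {Q = Q} (step _ _) (here refl) t∈Q | false = ⊥-elim (elem-false⇒∉ z Q eq t∈Q)
  firstCommon-isPath {z} {Q = Q} (step _ c) (there t∈P) t∈Q | false rewrite eq
    with firstCommon-isPath c t∈P t∈Q
  ... | m , fc≡m , m∈P , m∈Q , m-max = m , fc≡m , there m∈P , m∈Q , max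
    where
    max : ∀ {s} → s ∈ z ∷ _ → s ∈ Q → s ≤ m
    max (here refl) s∈Q = ⊥-elim (elem-false⇒∉ z Q eq s∈Q)
    max (there s∈P) s∈Q = m-max s∈P s∈Q

  nca-maxThreshold : ∀ {v w Pv Pw t} → IsPath p v Pv → IsPath p w Pw → t ∈ Pv → t ∈ Pw →
                     ∃ λ c → firstCommon Pv Pw ≡ just c × MaxThreshold p v w c
  nca-maxThreshold {v} {w} {Pv} {Pw} cv cw t∈Pv t∈Pw with firstCommon-isPath cv t∈Pv t∈Pw
  ... | c , fc≡c , c∈Pv , c∈Pw , c-max =
    c , fc≡c , isPath-≤ cv c∈Pv ,
    isPath⇒Conn-heap cv c∈Pv ≤-refl ◅◅ Conn-sym (isPath⇒Conn-heap cw c∈Pw ≤-refl) , maximal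
    where
    maximal : ∀ {a} → a ≤ v → Conn a p v w → a ≤ c
    maximal a≤v v~w with hasAncestorAboveIn-Conn (isPath-upClosed cv) v~w (v , ε , isPath-head cv , a≤v)
    ... | s , w↝s , s∈Pv , a≤s = ≤-trans a≤s (c-max s∈Pv (anc⇒∈isPath cw w↝s))

firstCommon-disjoint : ∀ P Q → (∀ {t} → t ∈ P → t ∈ Q → ⊥) → firstCommon P Q ≡ nothing
firstCommon-disjoint []      Q _ = refl
firstCommon-disjoint (x ∷ P) Q disjoint rewrite ∉⇒elem-false {x} {Q} (disjoint (here refl)) =
  firstCommon-disjoint P Q (disjoint ∘ there)

<ᵇ-true⇒< : ∀ m n → (m <ᵇ n) ≡ true → m < n
<ᵇ-true⇒< m n e = <ᵇ⇒< m n (Equivalence.from T-≡ e)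

largestBelow-sound : ∀ L z {y} → largestBelow L z ≡ just y → y ∈ L × y < z
largestBelow-sound (x ∷ xs) z e with x <ᵇ z in x<ᵇz
... | false = let y∈xs , y<z = largestBelow-sound xs z e in there y∈xs , y<z
... | true with largestBelow xs z in below
...   | nothing with refl ← e = here refl , <ᵇ-true⇒< x z x<ᵇz
...   | just y′ with refl ← e with ⊔-sel x y′
...     | inj₁ x⊔y′≡x rewrite x⊔y′≡x = here refl , <ᵇ-true⇒< x z x<ᵇz
...     | inj₂ x⊔y′≡y′ rewrite x⊔y′≡y′ =
  let y′∈xs , y′<z = largestBelow-sound xs z below in there y′∈xs , y′<z

largestBelow-max : ∀ L z {t} → t ∈ L → t < z → ∃ λ y → largestBelow L z ≡ just y × t ≤ y
largestBelow-max (x ∷ xs) z (here refl) t<z with x <ᵇ z in x<ᵇz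
... | false = ⊥-elim (subst T x<ᵇz (<⇒<ᵇ t<z))
... | true with largestBelow xs z
...   | nothing = _ , refl , ≤-refl
...   | just y  = _ , refl , m≤m⊔n x y
largestBelow-max (x ∷ xs) z (there t∈xs) t<z with x <ᵇ z | largestBelow-max xs z t∈xs t<z
... | false | below = below
... | true  | y , e , t≤y rewrite e = _ , refl , ≤-trans t≤y (m≤n⊔m x y)

mergeParent : Parent → List ℕ → Parent
mergeParent p L z = if elem z L then largestBelow L z else p z

module _ {p : Parent} {L : List ℕ} where

  mergeParent-∈ : ∀ {z} → z ∈ L → mergeParent p L z ≡ largestBelow L z
  mergeParent-∈ z∈L rewrite ∈⇒elem-true z∈L = refl

  mergeParent-∉ : ∀ {z} → z ∉ L → mergeParent p L z ≡ p z
  mergeParent-∉ z∉L rewrite ∉⇒elem-false z∉L = refl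

  mergeParent-heap : Heap p → Heap (mergeParent p L)
  mergeParent-heap heap {x} e with elem x L
  ... | true  = proj₂ (largestBelow-sound L x e)
  ... | false = heap e

LinkEdge : ℕ → ℕ → ℕ → ℕ → ℕ → Set
LinkEdge a v w x y = x ≡ v × y ≡ w × a ≤ v × a ≤ w

ConnWith : ℕ → Parent → ℕ → ℕ → ℕ → ℕ → Set
ConnWith a p v w = EqClosure (λ x y → Conn a p x y ⊎ LinkEdge a v w x y)

module _ {a : ℕ} {v w : ℕ} where

  Conn⇒ConnWith : ∀ {p x y} → Conn a p x y → ConnWith a p v w x y
  Conn⇒ConnWith c = Eq.return (inj₁ c)

  link-ConnWith : ∀ {p} → a ≤ v → a ≤ w → ConnWith a p v w v w
  link-ConnWith a≤v a≤w = Eq.return (inj₂ (refl , refl , a≤v , a≤w))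

  ConnWith-map : ∀ {p q} → (∀ {x y} → Conn a p x y → Conn a q x y) →
                 ∀ {x y} → ConnWith a p v w x y → ConnWith a q v w x y
  ConnWith-map f = Eq.map [ inj₁ ∘ f , inj₂ ]

  ConnWith-elim : ∀ {p q} → (∀ {x y} → Conn a p x y → Conn a q x y) →
                  (a ≤ v → a ≤ w → Conn a q v w) →
                  ∀ {x y} → ConnWith a p v w x y → Conn a q x y
  ConnWith-elim f link = [ f , (λ { (refl , refl , a≤v , a≤w) → link a≤v a≤w }) ] ⋆

module Merge {p : Parent} (heap : Heap p) {v w Pv Pw} (cv : IsPath p v Pv) (cw : IsPath p w Pw) where

  L : List ℕ
  L = Pv ++ Pw

  merged : Parent
  merged = mergeParent p L

  L-descend : ∀ {a y} z → Acc _<_ z → z ∈ L → y ∈ L → a ≤ y → y ≤ z → Conn a merged z y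
  L-descend {a} {y} z (acc rs) z∈L y∈L a≤y y≤z with m≤n⇒m<n∨m≡n y≤z
  ... | inj₂ refl = ε
  ... | inj₁ y<z with largestBelow-max L z y∈L y<z
  ... | b , below≡b , y≤b with largestBelow-sound L z below≡b
  ... | b∈L , b<z =
    arc (trans (mergeParent-∈ {p = p} z∈L) below≡b) (≤-trans a≤y y≤z) (≤-trans a≤y y≤b)
    ◅◅ L-descend b (rs b<z) b∈L y∈L a≤y y≤b

  L-Conn-merged : ∀ {a x y} → x ∈ L → y ∈ L → a ≤ x → a ≤ y → Conn a merged x y
  L-Conn-merged {x = x} {y} x∈L y∈L a≤x a≤y with ≤-total y x
  ... | inj₁ y≤x = L-descend x (<-wellFounded x) x∈L y∈L a≤y y≤x
  ... | inj₂ x≤y = Conn-sym (L-descend y (<-wellFounded y) y∈L x∈L a≤x x≤y)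

  via-v : ∀ {a t} → t ∈ Pv → a ≤ t → Conn a p v t
  via-v = isPath⇒Conn-heap heap cv

  via-w : ∀ {a t} → t ∈ Pw → a ≤ t → Conn a p w t
  via-w = isPath⇒Conn-heap heap cw

  L-ConnWith : ∀ {a x y} → x ∈ L → y ∈ L → a ≤ x → a ≤ y → ConnWith a p v w x y
  L-ConnWith {a} x∈L y∈L a≤x a≤y with ∈-++⁻ Pv x∈L | ∈-++⁻ Pv y∈L
  ... | inj₁ x∈Pv | inj₁ y∈Pv = Conn⇒ConnWith (Conn-sym (via-v x∈Pv a≤x) ◅◅ via-v y∈Pv a≤y)
  ... | inj₂ x∈Pw | inj₂ y∈Pw = Conn⇒ConnWith (Conn-sym (via-w x∈Pw a≤x) ◅◅ via-w y∈Pw a≤y)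
  ... | inj₁ x∈Pv | inj₂ y∈Pw =
    Conn⇒ConnWith (Conn-sym (via-v x∈Pv a≤x))
    ◅◅ link-ConnWith (≤-trans a≤x (isPath-≤ heap cv x∈Pv)) (≤-trans a≤y (isPath-≤ heap cw y∈Pw))
    ◅◅ Conn⇒ConnWith (via-w y∈Pw a≤y)
  ... | inj₂ x∈Pw | inj₁ y∈Pv =
    Conn⇒ConnWith (Conn-sym (via-w x∈Pw a≤x))
    ◅◅ Eq.symmetric _ (link-ConnWith (≤-trans a≤y (isPath-≤ heap cv y∈Pv))
                                     (≤-trans a≤x (isPath-≤ heap cw x∈Pw)))
    ◅◅ Conn⇒ConnWith (via-v y∈Pv a≤y)

  L-up : UpClosed p L
  L-up x∈L e with ∈-++⁻ Pv x∈L
  ... | inj₁ x∈Pv = ∈-++⁺ˡ (isPath-upClosed cv x∈Pv e)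
  ... | inj₂ x∈Pw = ∈-++⁺ʳ Pv (isPath-upClosed cw x∈Pw e)

  merged⇒ConnWith : ∀ {a x y} → Conn a merged x y → ConnWith a p v w x y
  merged⇒ConnWith = edge⇒ ⋆
    where
    edge⇒ : ∀ {a x y} → Edge a merged x y → ConnWith a p v w x y
    edge⇒ {x = x} (e , a≤x , a≤y) with elem x L in x∈?L
    ... | true  = L-ConnWith (elem-true⇒∈ x L x∈?L) (proj₁ (largestBelow-sound L x e)) a≤x a≤y
    ... | false = Conn⇒ConnWith (arc e a≤x a≤y)

  ConnWith⇒merged : ∀ {a x y} → ConnWith a p v w x y → Conn a merged x y
  ConnWith⇒merged =
    ConnWith-elim (edge⇒ ⋆) (L-Conn-merged (∈-++⁺ˡ (isPath-head cv)) (∈-++⁺ʳ Pv (isPath-head cw)))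
    where
    edge⇒ : ∀ {a x y} → Edge a p x y → Conn a merged x y
    edge⇒ {x = x} (e , a≤x , a≤y) with elem x L in x∈?L
    ... | true  = let x∈L = elem-true⇒∈ x L x∈?L in L-Conn-merged x∈L (L-up x∈L e) a≤x a≤y
    ... | false = arc (trans (mergeParent-∉ {p = p} (elem-false⇒∉ x L x∈?L)) e) a≤x a≤y

data Consecutive : List ℕ → ℕ → ℕ → Set where
  here  : ∀ {y z r} → Consecutive (y ∷ z ∷ r) y z
  there : ∀ {x xs y z} → Consecutive xs y z → Consecutive (x ∷ xs) y z

consecutive-∈ : ∀ {xs y z} → Consecutive xs y z → z ∈ xs
consecutive-∈ here      = there (here refl)
consecutive-∈ (there c) = there (consecutive-∈ c)

consecutive-∈-tail : ∀ {x xs y z} → Consecutive (x ∷ xs) y z → z ∈ xs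
consecutive-∈-tail here      = here refl
consecutive-∈-tail (there c) = consecutive-∈ c

prevIn-sound : ∀ xs z {y} → prevIn xs z ≡ just y → Consecutive xs y z
prevIn-sound (a ∷ rest) z = go a rest
  where
  go : ∀ a rest {y} → prevIn (a ∷ rest) z ≡ just y → Consecutive (a ∷ rest) y z
  go a (b ∷ r) e with b ≟ z
  ... | yes refl rewrite ≡ᵇ-refl b with refl ← e = here
  ... | no b≢z rewrite ≢⇒≡ᵇ-false b z b≢z = there (go b r e)

prevIn-complete : ∀ {xs y z} → Unique xs → Consecutive xs y z → prevIn xs z ≡ just y
prevIn-complete {z = z} _ here rewrite ≡ᵇ-refl z = refl
prevIn-complete {_ ∷ b ∷ _} {z = z} (_ ∷ b∉ ∷ u) (there c)
  rewrite ≢⇒≡ᵇ-false b z (λ { refl → All.lookup b∉ (consecutive-∈-tail c) refl }) =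
  prevIn-complete (b∉ ∷ u) c

prevIn-∉ : ∀ x xs {z} → z ∉ xs → prevIn (x ∷ xs) z ≡ nothing
prevIn-∉ x []      _   = refl
prevIn-∉ x (b ∷ r) {z} z∉ rewrite ≢⇒≡ᵇ-false b z (λ { refl → z∉ (here refl) }) =
  prevIn-∉ b r (z∉ ∘ there)

module _ {p : Parent} where

  isPath-consecutive⇒ : ∀ {z xs y t} → IsPath p z xs → Consecutive xs y t → p y ≡ just t
  isPath-consecutive⇒ (step e (end _))    here      = e
  isPath-consecutive⇒ (step e (step _ _)) here      = e
  isPath-consecutive⇒ (step _ c)          (there k) = isPath-consecutive⇒ c k

  isPath-consecutive⇐ : ∀ {z xs y t} → IsPath p z xs → y ∈ xs → p y ≡ just t → Consecutive xs y t
  isPath-consecutive⇐ (end e) (here refl) e′ with trans (sym e) e′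
  ... | ()
  isPath-consecutive⇐ (step e (end _)) (here refl) e′ with just-injective (trans (sym e) e′)
  ... | refl = here
  isPath-consecutive⇐ (step e (step _ _)) (here refl) e′ with just-injective (trans (sym e) e′)
  ... | refl = here
  isPath-consecutive⇐ (step _ c) (there y∈) e′ = there (isPath-consecutive⇐ c y∈ e′)

  isPath-prevIn-head : ∀ {z xs} → IsPath p z xs → prevIn xs z ≡ nothing
  isPath-prevIn-head c with c | isPath-unique c
  ... | end _    | _      = refl
  ... | step _ _ | z∉ ∷ _ = prevIn-∉ _ _ (λ z∈ → All.lookup z∉ z∈ refl)

evertParent : Parent → List ℕ → Parent
evertParent p P z = if elem z P then prevIn P z else p z

module Evert {p : Parent} {v P} (cP : IsPath p v P) where

  everted : Parent
  everted = evertParent p P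

  everted-∈ : ∀ {z} → z ∈ P → everted z ≡ prevIn P z
  everted-∈ z∈P rewrite ∈⇒elem-true z∈P = refl

  everted-∉ : ∀ {z} → z ∉ P → everted z ≡ p z
  everted-∉ z∉P rewrite ∉⇒elem-false z∉P = refl

  v-root : everted v ≡ nothing
  v-root = trans (everted-∈ (isPath-head cP)) (isPath-prevIn-head cP)

  reversed : ∀ {x y} → p x ≡ just y → x ∈ P → everted y ≡ just x
  reversed e x∈P = let k = isPath-consecutive⇐ cP x∈P e in
    trans (everted-∈ (consecutive-∈ k)) (prevIn-complete (isPath-unique cP) k)

  arc⁻ : ∀ {x y} → everted x ≡ just y → (p y ≡ just x × x ∈ P) ⊎ p x ≡ just y
  arc⁻ {x} e with elem x P in x∈?P
  ... | true  = let x∈P = elem-true⇒∈ x P x∈?P in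
                inj₁ (isPath-consecutive⇒ cP (prevIn-sound P x e) , x∈P)
  ... | false = inj₂ e

  arc⁺ : ∀ {x y} → p x ≡ just y → everted y ≡ just x ⊎ everted x ≡ just y
  arc⁺ {x} e with x ∈? P
  ... | yes x∈P = inj₁ (reversed e x∈P)
  ... | no  x∉P = inj₂ (trans (everted-∉ x∉P) e)

  Conn-evert⁻ : ∀ {a x y} → Conn a everted x y → Conn a p x y
  Conn-evert⁻ = edge⇒ ⋆
    where
    edge⇒ : ∀ {a x y} → Edge a everted x y → Conn a p x y
    edge⇒ (e , a≤x , a≤y) with arc⁻ e
    ... | inj₁ (e′ , _) = Conn-sym (arc e′ a≤y a≤x)
    ... | inj₂ e′       = arc e′ a≤x a≤y

  Conn-evert⁺ : ∀ {a x y} → Conn a p x y → Conn a everted x y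
  Conn-evert⁺ = edge⇒ ⋆
    where
    edge⇒ : ∀ {a x y} → Edge a p x y → Conn a everted x y
    edge⇒ (e , a≤x , a≤y) with arc⁺ e
    ... | inj₁ e′ = Conn-sym (arc e′ a≤y a≤x)
    ... | inj₂ e′ = arc e′ a≤x a≤y

  rooted-P : ∀ {z} → z ∈ P → Rooted everted z
  rooted-P = go cP (λ z∈ → z∈) (done v-root)
    where
    go : ∀ {y ys} → IsPath p y ys → (∀ {t} → t ∈ ys → t ∈ P) → Rooted everted y →
         ∀ {z} → z ∈ ys → Rooted everted z
    go (end _)    _    r (here refl) = r
    go (step _ _) _    r (here refl) = r
    go (step e c) ys⊆P r (there z∈) =
      go c (ys⊆P ∘ there) (next (reversed e (ys⊆P (here refl))) r) z∈

  evert-rooted : ∀ {z} → Rooted p z → Rooted everted z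
  evert-rooted {z} r with z ∈? P
  evert-rooted (done e)   | no z∉P = done (trans (everted-∉ z∉P) e)
  evert-rooted (next e r) | no z∉P = next (trans (everted-∉ z∉P) e) (evert-rooted r)
  ... | yes z∈P = rooted-P z∈P

  evert-closed : ∀ {N} → Closed p N → v ∈ N → Closed everted N
  evert-closed cl v∈N e with arc⁻ e
  ... | inj₁ (e′ , x∈P) = isPath-⊆ (closed⇒upClosed cl) v∈N cP x∈P , proj₁ (cl e′)
  ... | inj₂ e′         = cl e′

update-≡ : ∀ p v m → update p v m v ≡ m
update-≡ p v m rewrite ≡ᵇ-refl v = refl

update-≢ : ∀ p v m {z} → z ≢ v → update p v m z ≡ p z
update-≢ p v m {z} z≢v rewrite ≢⇒≡ᵇ-false z v z≢v = refl

module _ {p q : Parent} (p≗q : p ≗ q) where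

  Rooted-≗ : ∀ {z} → Rooted p z → Rooted q z
  Rooted-≗ (done e)   = done (trans (sym (p≗q _)) e)
  Rooted-≗ (next e r) = next (trans (sym (p≗q _)) e) (Rooted-≗ r)

  Conn-≗ : ∀ {a x y} → Conn a p x y → Conn a q x y
  Conn-≗ = Eq.map (λ (e , a≤x , a≤y) → trans (sym (p≗q _)) e , a≤x , a≤y)

update-nothing-≗ : ∀ {p v} → p v ≡ nothing → update p v nothing ≗ p
update-nothing-≗ {p} {v} pv≡nothing z with z ≟ v
... | yes refl = trans (update-≡ p v nothing) (sym pv≡nothing)
... | no  z≢v  = update-≢ p v nothing z≢v

update-closed : ∀ {p N v m} → Closed p N → v ∈ N → (∀ {y} → m ≡ just y → y ∈ N) →
                Closed (update p v m) N
update-closed {p} {N} {v} {m} cl v∈N m∈N {x} e with x ≟ v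
... | yes refl = v∈N , m∈N (trans (sym (update-≡ p v m)) e)
... | no  x≢v  = cl (trans (sym (update-≢ p v m x≢v)) e)

module Link {p : Parent} {v : ℕ} (v-root : p v ≡ nothing) (w : ℕ) where

  linked : Parent
  linked = update p v (just w)

  link-preserves : ∀ {x y} → p x ≡ just y → linked x ≡ just y
  link-preserves {x} e with x ≟ v
  ... | yes refl with () ← trans (sym v-root) e
  ... | no x≢v = trans (update-≢ p v _ x≢v) e

  Conn-link⁺ : ∀ {a x y} → Conn a p x y → Conn a linked x y
  Conn-link⁺ = (λ (e , a≤x , a≤y) → arc (link-preserves e) a≤x a≤y) ⋆

  ConnWith⇒link : ∀ {a x y} → ConnWith a p v w x y → Conn a linked x y
  ConnWith⇒link = ConnWith-elim Conn-link⁺ (arc (update-≡ p v (just w)))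

  link⇒ConnWith : ∀ {a x y} → Conn a linked x y → ConnWith a p v w x y
  link⇒ConnWith = edge⇒ ⋆
    where
    edge⇒ : ∀ {a x y} → Edge a linked x y → ConnWith a p v w x y
    edge⇒ {x = x} (e , a≤x , a≤y) with x ≟ v
    ... | yes refl with refl ← just-injective (trans (sym (update-≡ p v (just w))) e) =
      link-ConnWith a≤x a≤y
    ... | no x≢v = Conn⇒ConnWith (arc (trans (sym (update-≢ p v _ x≢v)) e) a≤x a≤y)

  rooted-avoiding : ∀ {z} → Rooted p z → ¬ Anc p z v → Rooted linked z
  rooted-avoiding {z} r z↛v with z ≟ v
  ... | yes refl = ⊥-elim (z↛v ε)
  rooted-avoiding (done e)   _   | no z≢v = done (trans (update-≢ p v _ z≢v) e)
  rooted-avoiding (next e r) z↛v | no z≢v = next (link-preserves e) (rooted-avoiding r (z↛v ∘ (e ◅_)))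

  link-rooted : (∀ z → Rooted p z) → ¬ Anc p w v → ∀ z → Rooted linked z
  link-rooted all-rooted w↛v z = go (all-rooted z)
    where
    go : ∀ {z} → Rooted p z → Rooted linked z
    go {z} r with z ≟ v
    ... | yes refl = next (update-≡ p v (just w)) (rooted-avoiding (all-rooted w) w↛v)
    go (done e)   | no z≢v = done (trans (update-≢ p v _ z≢v) e)
    go (next e r) | no z≢v = next (link-preserves e) (go r)

module Cut {p : Parent} (u : ℕ) where

  cut-parent : Parent
  cut-parent = update p u nothing

  cut-preserves : ∀ {x y} → x ≢ u → p x ≡ just y → cut-parent x ≡ just y
  cut-preserves x≢u e = trans (update-≢ p u nothing x≢u) e

  cut-reflects : ∀ {x y} → cut-parent x ≡ just y → p x ≡ just y
  cut-reflects {x} e with x ≟ u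
  ... | yes refl with () ← trans (sym (update-≡ p u nothing)) e
  ... | no x≢u = trans (sym (update-≢ p u nothing x≢u)) e

  cut-rooted : ∀ {z} → Rooted p z → Rooted cut-parent z
  cut-rooted {z} r with z ≟ u
  ... | yes refl = done (update-≡ p u nothing)
  cut-rooted (done e)   | no z≢u = done (trans (update-≢ p u nothing z≢u) e)
  cut-rooted (next e r) | no z≢u = next (cut-preserves z≢u e) (cut-rooted r)

  Conn-cut⁻ : ∀ {a x y} → Conn a cut-parent x y → Conn a p x y
  Conn-cut⁻ = (λ (e , a≤x , a≤y) → arc (cut-reflects e) a≤x a≤y) ⋆

  isPath-to-cut : ∀ {a z xs} → IsPath p z xs → u ∈ xs → (∀ {t} → t ∈ xs → a ≤ t) →
                  Anc cut-parent z u × Conn a cut-parent z u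
  isPath-to-cut {z = z} c u∈ a≤xs with z ≟ u
  ... | yes refl = ε , ε
  isPath-to-cut (end _)    (here refl) _ | no z≢u = ⊥-elim (z≢u refl)
  isPath-to-cut (step _ _) (here refl) _ | no z≢u = ⊥-elim (z≢u refl)
  isPath-to-cut (step e c) (there u∈) a≤xs | no z≢u =
    let z↝u , z~u = isPath-to-cut c u∈ (a≤xs ∘ there) in
    cut-preserves z≢u e ◅ z↝u ,
    arc (cut-preserves z≢u e) (a≤xs (here refl)) (a≤xs (there (isPath-head c))) ◅◅ z~u

  isPath-avoiding-cut : ∀ {a z xs y} → IsPath p z xs → u ∉ xs → (∀ {t} → t ∈ xs → a ≤ t) →
                        y ∈ xs → Conn a cut-parent z y
  isPath-avoiding-cut (end _)    _   _    (here refl) = ε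
  isPath-avoiding-cut (step _ _) _   _    (here refl) = ε
  isPath-avoiding-cut (step e c) u∉ a≤xs (there y∈)  =
    arc (cut-preserves (λ { refl → u∉ (here refl) }) e) (a≤xs (here refl)) (a≤xs (there (isPath-head c)))
    ◅◅ isPath-avoiding-cut c (u∉ ∘ there) (a≤xs ∘ there) y∈

record AddsEdge (seen : List ℕ) (D D′ : Forest) (v w : ℕ) : Set where
  field
    nodes-≡ : nodes D′ ≡ nodes D
    closed  : Closed (par D′) seen
    rooted  : ∀ z → Rooted (par D′) z
    added⁺  : ∀ {a x y} → ConnWith a (par D) v w x y → Conn a (par D′) x y
    added⁻  : ∀ {a x y} → Conn a (par D′) x y → ConnWith a (par D) v w x y

-- G is the auxiliary heap-ordered forest: the mergeable forest together with
-- its deleted leaves.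
record Simulation (seen : List ℕ) (H D : Forest) : Set where
  field
    G         : Parent
    G-heap    : Heap G
    G-closed  : Closed G seen
    H≗G       : ∀ {z} → z ∈ nodes H → par H z ≡ G z
    G-live    : ∀ {z u} → z ∈ nodes H → G z ≡ just u → u ∈ nodes H
    live⊆seen : ∀ {z} → z ∈ nodes H → z ∈ seen
    dead-root : ∀ {z} → z ∉ nodes H → par H z ≡ nothing
    D-nodes   : nodes D ≡ seen
    D-closed  : Closed (par D) seen
    D-rooted  : ∀ z → Rooted (par D) z
    G⇒D       : ∀ {a x y} → Conn a G x y → Conn a (par D) x y
    D⇒G       : ∀ {a x y} → Conn a (par D) x y → Conn a G x y

module Simulated {seen H D} (S : Simulation seen H D) where
  open Simulation S

  G-path : ∀ z → ∃ (IsPath G z)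
  G-path = heap-isPath G-heap

  H-closed : Closed (par H) (nodes H)
  H-closed {x} e with x ∈? nodes H
  ... | yes x∈H = x∈H , G-live x∈H (trans (sym (H≗G x∈H)) e)
  ... | no  x∉H with () ← trans (sym (dead-root x∉H)) e

  G-path-live : ∀ {z xs} → z ∈ nodes H → IsPath G z xs → ∀ {t} → t ∈ xs → t ∈ nodes H
  G-path-live = isPath-⊆ G-live

  path-H : ∀ {z xs} → z ∈ nodes H → IsPath G z xs → path H z ≡ xs
  path-H z∈H c = path-isPath {F = H} H-closed (as-H c z∈H)
    where
    as-H : ∀ {z xs} → IsPath G z xs → z ∈ nodes H → IsPath (par H) z xs
    as-H (end e)    z∈H = end (trans (H≗G z∈H) e)
    as-H (step e c) z∈H = step (trans (H≗G z∈H) e) (as-H c (G-live z∈H e))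

  D-closed-nodes : Closed (par D) (nodes D)
  D-closed-nodes = subst (Closed (par D)) (sym D-nodes) D-closed

  path-D : ∀ {z xs} → IsPath (par D) z xs → path D z ≡ xs
  path-D = path-isPath {F = D} D-closed-nodes

  D-isPath : ∀ z → IsPath (par D) z (path D z)
  D-isPath z with rooted⇒isPath (D-rooted z)
  ... | _ , c rewrite path-D c = c

  root-D : ∀ z → RootOf (par D) z (root D z)
  root-D z = isPath-rootOf (D-isPath z)

  treemin-rootOf : ∀ {z r} → z ∈ nodes H → RootOf G z r → treemin D z ≡ r
  treemin-rootOf {z} {r} z∈H (z↝r , r-root) =
    ≤-antisym (foldr-⊓-≤ z tree r∈tree) (≤-foldr-⊓ z tree (anc-≤ G-heap z↝r) r≤tree)
    where
    sameRoot : ℕ → Bool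
    sameRoot u = root D u ≡ᵇ root D z
    tree : List ℕ
    tree = filterᵇ sameRoot (nodes D)
    r∈tree : r ∈ tree
    r∈tree = ∈-filterᵇ⁺ sameRoot (nodes D) (subst (r ∈_) (sym D-nodes) (live⊆seen r∈H))
      (subst (λ t → (t ≡ᵇ root D z) ≡ true)
             (rootOf-unique (rootOf-Conn (G⇒D (anc⇒Conn₀ z↝r)) (root-D z)) (root-D r))
             (≡ᵇ-refl (root D z)))
      where
      r∈H : r ∈ nodes H
      r∈H = let _ , c = G-path z in G-path-live z∈H c (anc⇒∈isPath c z↝r)
    r≤tree : ∀ {t} → t ∈ tree → r ≤ t
    r≤tree {t} t∈ with ∈-filterᵇ⁻ sameRoot (nodes D) t∈
    ... | _ , same = anc-≤ G-heap (proj₁ (rootOf-Conn (D⇒G t~z) (z↝r , r-root)))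
      where
      t~z : Conn 0 (par D) z t
      t~z = anc⇒Conn₀ (proj₁ (root-D z))
            ◅◅ Conn-sym (subst (Conn 0 (par D) t) (≡ᵇ-true⇒≡ _ _ same) (anc⇒Conn₀ (proj₁ (root-D t))))

  data Trees (v w : ℕ) : Set where
    apart    : sameTree D v w ≡ false → ¬ Conn 0 G v w → Trees v w
    together : sameTree D v w ≡ true → Conn 0 G w v → Trees v w

  trees : ∀ {v w} → v ∈ nodes H → w ∈ nodes H → Trees v w
  trees {v} {w} v∈H w∈H with G-path v | G-path w
  ... | Pv , cv | Pw , cw = classify (lastOr v Pv ≟ lastOr w Pw)
    where
    v↝rv : RootOf G v (lastOr v Pv)
    v↝rv = isPath-rootOf cv
    w↝rw : RootOf G w (lastOr w Pw)
    w↝rw = isPath-rootOf cw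
    roots : sameTree D v w ≡ (lastOr v Pv ≡ᵇ lastOr w Pw)
    roots = cong₂ _≡ᵇ_ (treemin-rootOf v∈H v↝rv) (treemin-rootOf w∈H w↝rw)
    classify : Dec (lastOr v Pv ≡ lastOr w Pw) → Trees v w
    classify (no rv≢rw) =
      apart (trans roots (≢⇒≡ᵇ-false _ _ rv≢rw))
            (λ v~w → rv≢rw (rootOf-unique (rootOf-Conn v~w v↝rv) w↝rw))
    classify (yes rv≡rw) =
      together (trans roots (trans (cong (_≡ᵇ lastOr w Pw) rv≡rw) (≡ᵇ-refl (lastOr w Pw))))
               (anc⇒Conn₀ (proj₁ w↝rw) ◅◅ Conn-sym (subst (Conn 0 G v) rv≡rw (anc⇒Conn₀ (proj₁ v↝rv))))

  module Everted {v} (v∈H : v ∈ nodes H) where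
    open Evert (D-isPath v) public

    D′ : Forest
    D′ = evert D v

    everted-closed : Closed everted seen
    everted-closed = evert-closed D-closed (live⊆seen v∈H)

    simulation : Simulation seen H D′
    simulation = record
      { G = G ; G-heap = G-heap ; G-closed = G-closed ; H≗G = H≗G ; G-live = G-live
      ; live⊆seen = live⊆seen ; dead-root = dead-root ; D-nodes = D-nodes
      ; D-closed = everted-closed
      ; D-rooted = evert-rooted ∘ D-rooted
      ; G⇒D      = Conn-evert⁺ ∘ G⇒D
      ; D⇒G      = D⇒G ∘ Conn-evert⁻
      }

    path-D′ : ∀ {z xs} → IsPath everted z xs → path D′ z ≡ xs
    path-D′ = path-isPath {F = D′} (subst (Closed everted) (sym D-nodes) everted-closed)

    link-addsEdge : ∀ {w} → w ∈ nodes H → ¬ Anc everted w v → AddsEdge seen D (link D′ v w) v w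
    link-addsEdge {w} w∈H w↛v = record
      { nodes-≡ = refl
      ; closed  = update-closed everted-closed (live⊆seen v∈H) (λ { refl → live⊆seen w∈H })
      ; rooted  = link-rooted (evert-rooted ∘ D-rooted) w↛v
      ; added⁺  = ConnWith⇒link ∘ ConnWith-map Conn-evert⁺
      ; added⁻  = ConnWith-map Conn-evert⁻ ∘ link⇒ConnWith
      }
      where open Link {everted} v-root w

    module SameTree {w} (w~v : Conn 0 G w v) where

      ws : List ℕ
      ws = proj₁ (rooted⇒isPath (evert-rooted (D-rooted w)))

      cws : IsPath everted w ws
      cws = proj₂ (rooted⇒isPath (evert-rooted (D-rooted w)))

      w↝v : RootOf everted w v
      w↝v = rootOf-Conn (Conn-sym (Conn-evert⁺ (G⇒D w~v))) (ε , v-root)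

      v∈ws : v ∈ ws
      v∈ws = anc⇒∈isPath cws (proj₁ w↝v)

      m : ℕ
      m = foldr _⊓_ w ws

      pathmin≡m : pathmin D′ w ≡ m
      pathmin≡m = cong (foldr _⊓_ w) (path-D′ cws)

      m-maxThreshold : MaxThreshold everted v w m
      m-maxThreshold = pathmin-maxThreshold v-root cws v∈ws

      m∈ws : m ∈ ws
      m∈ws = isPath-foldr-⊓-∈ cws

      redundant-addsEdge : m ≡ v ⊎ m ≡ w → AddsEdge seen D D′ v w
      redundant-addsEdge m∈vw = record
        { nodes-≡ = refl
        ; closed  = everted-closed
        ; rooted  = evert-rooted ∘ D-rooted
        ; added⁺  = ConnWith-elim Conn-evert⁺
                      (λ a≤v a≤w → Conn-anti (a≤m a≤v a≤w) (proj₁ (proj₂ m-maxThreshold)))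
        ; added⁻  = Conn⇒ConnWith ∘ Conn-evert⁻
        }
        where
        a≤m : ∀ {a} → a ≤ v → a ≤ w → a ≤ m
        a≤m a≤v a≤w = [ (λ m≡v → subst (_ ≤_) (sym m≡v) a≤v) , (λ m≡w → subst (_ ≤_) (sym m≡w) a≤w) ]
                        m∈vw

      cut-link-addsEdge : w ∈ nodes H → m ≢ v → AddsEdge seen D (link (cut D′ m) v w) v w
      cut-link-addsEdge w∈H m≢v = record
        { nodes-≡ = refl
        ; closed  = update-closed (everted-closed ∘ cut-reflects) (live⊆seen v∈H) (λ { refl → live⊆seen w∈H })
        ; rooted  = link-rooted (cut-rooted ∘ evert-rooted ∘ D-rooted) w↛v
        ; added⁺  = ConnWith-elim ((edge⇒ ⋆) ∘ Conn-evert⁺) (arc (update-≡ cut-parent v (just w)))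
        ; added⁻  = ConnWith-map (Conn-evert⁻ ∘ Conn-cut⁻) ∘ link⇒ConnWith
        }
        where
        open Cut {everted} m
        v-root′ : cut-parent v ≡ nothing
        v-root′ = trans (update-≢ everted m nothing (m≢v ∘ sym)) v-root
        open Link {cut-parent} {v} v-root′ w

        w↛v : ¬ Anc cut-parent w v
        w↛v w↝v′ = m≢v (rootOf-unique w↝m (w↝v′ , v-root′))
          where
          w↝m : RootOf cut-parent w m
          w↝m = proj₁ (isPath-to-cut {a = 0} cws m∈ws (λ _ → z≤n)) , update-≡ everted m nothing

        -- For a ≤ m the lost arc m → u is bypassed through the cycle closed by
        -- v–w, all of whose nodes lie on ws and so are ≥ m.
        bypass : ∀ {a u} → everted m ≡ just u → a ≤ m → Conn a linked m u
        bypass {a} {u} e a≤m with rooted⇒isPath (evert-rooted (D-rooted u))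
        ... | us , cus =
          Conn-sym (Conn-link⁺ w~m)
          ◅◅ Conn-sym (arc (update-≡ cut-parent v (just w)) (a≤ws v∈ws) (a≤ws (isPath-head cws)))
          ◅◅ Conn-sym (Conn-link⁺ u~v)
          where
          a≤ws : ∀ {t} → t ∈ ws → a ≤ t
          a≤ws t∈ = ≤-trans a≤m (foldr-⊓-≤ w ws t∈)
          w~m : Conn a cut-parent w m
          w~m = proj₂ (isPath-to-cut cws m∈ws a≤ws)
          u∈ws : u ∈ ws
          u∈ws = isPath-upClosed cws m∈ws e
          us⊆ws : ∀ {t} → t ∈ us → t ∈ ws
          us⊆ws t∈ = anc⇒∈isPath cws (isPath⇒anc cws u∈ws ◅◅ isPath⇒anc cus t∈)
          m∉us : m ∉ us
          m∉us m∈ = rooted-acyclic (evert-rooted (D-rooted m)) e (isPath⇒anc cus m∈)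
          v∈us : v ∈ us
          v∈us = anc⇒∈isPath cus (proj₁ (rootOf-Conn (anc⇒Conn₀ (isPath⇒anc cws u∈ws)) w↝v))
          u~v : Conn a cut-parent u v
          u~v = isPath-avoiding-cut cus m∉us (a≤ws ∘ us⊆ws) v∈us

        edge⇒ : ∀ {a x y} → Edge a everted x y → Conn a linked x y
        edge⇒ {x = x} (e , a≤x , a≤y) with x ≟ m
        ... | yes refl = bypass e a≤x
        ... | no  x≢m  = Conn-link⁺ (arc (cut-preserves x≢m e) a≤x a≤y)

  root-correct : ∀ {v} → v ∈ nodes H → root H v ≡ treemin D v
  root-correct v∈H with G-path _
  ... | _ , c = trans (cong (lastOr _) (path-H v∈H c)) (sym (treemin-rootOf v∈H (isPath-rootOf c)))

  nca-correct : ∀ {v w} → v ∈ nodes H → w ∈ nodes H →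
                Σ Forest λ D″ → simNca D v w ≡ (D″ , nca H v w) × Simulation seen H D″
  nca-correct {v} {w} v∈H w∈H with G-path v | G-path w | trees v∈H w∈H
  ... | Pv , cv | Pw , cw | apart different v≁w = D , answer , S
    where
    disjoint : ∀ {t} → t ∈ Pv → t ∈ Pw → ⊥
    disjoint t∈Pv t∈Pw =
      v≁w (anc⇒Conn₀ (isPath⇒anc cv t∈Pv) ◅◅ Conn-sym (anc⇒Conn₀ (isPath⇒anc cw t∈Pw)))
    answer : simNca D v w ≡ (D , nca H v w)
    answer rewrite different | path-H v∈H cv | path-H w∈H cw =
      cong (D ,_) (sym (firstCommon-disjoint Pv Pw disjoint))
  ... | Pv , cv | Pw , cw | together same w~v = D′ , answer , simulation
    where
    open Everted v∈H
    open SameTree w~v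
    v↝r : RootOf G v (lastOr v Pv)
    v↝r = isPath-rootOf cv
    answer : simNca D v w ≡ (D′ , nca H v w)
    answer with nca-maxThreshold G-heap cv cw (anc⇒∈isPath cv (proj₁ v↝r))
                  (anc⇒∈isPath cw (proj₁ (rootOf-Conn (Conn-sym w~v) v↝r)))
    ... | c , fc≡c , c-max rewrite same | path-H v∈H cv | path-H w∈H cw | fc≡c =
      cong (λ t → D′ , just t)
        (trans pathmin≡m
               (maxThreshold-unique (D⇒G ∘ Conn-evert⁻) (Conn-evert⁺ ∘ G⇒D) m-maxThreshold c-max))

  simMerge-addsEdge : ∀ {v w} → v ∈ nodes H → w ∈ nodes H → AddsEdge seen D (simMerge D v w) v w
  simMerge-addsEdge {v} {w} v∈H w∈H with trees v∈H w∈H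
  ... | apart different v≁w rewrite different =
    link-addsEdge w∈H (λ w↝v → v≁w (Conn-sym (D⇒G (Conn-evert⁻ (anc⇒Conn₀ w↝v)))))
    where open Everted v∈H
  ... | together same w~v rewrite same with elem (pathmin (evert D v) w) (v ∷ w ∷ []) in u∈?vw
  ...   | true  = redundant-addsEdge (u∈vw (elem-true⇒∈ _ _ u∈?vw))
    where
    open Everted v∈H
    open SameTree w~v
    u∈vw : pathmin D′ w ∈ v ∷ w ∷ [] → m ≡ v ⊎ m ≡ w
    u∈vw (here u≡v)         = inj₁ (trans (sym pathmin≡m) u≡v)
    u∈vw (there (here u≡w)) = inj₂ (trans (sym pathmin≡m) u≡w)
  ...   | false = subst (λ u → AddsEdge seen D (link (cut D′ u) v w) v w) (sym pathmin≡m)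
                    (cut-link-addsEdge w∈H
                       (λ m≡v → elem-false⇒∉ _ (v ∷ w ∷ []) u∈?vw (here (trans pathmin≡m m≡v))))
    where
    open Everted v∈H
    open SameTree w~v

  merge-simulation : ∀ {v w} → v ∈ nodes H → w ∈ nodes H →
                     Simulation seen (mergeH H v w) (simMerge D v w)
  merge-simulation {v} {w} v∈H w∈H = record
    { G         = merged
    ; G-heap    = mergeParent-heap {L = L} G-heap
    ; G-closed  = merged-closed
    ; H≗G       = λ z∈H → trans (cong (λ L′ → mergeParent (par H) L′ _) paths≡L) (agree z∈H)
    ; G-live    = merged-live
    ; live⊆seen = live⊆seen
    ; dead-root = λ z∉H → trans (cong (λ L′ → mergeParent (par H) L′ _) paths≡L)
                                (trans (mergeParent-∉ {p = par H} (z∉H ∘ L-live)) (dead-root z∉H))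
    ; D-nodes   = trans nodes-≡ D-nodes
    ; D-closed  = closed
    ; D-rooted  = rooted
    ; G⇒D       = added⁺ ∘ ConnWith-map G⇒D ∘ merged⇒ConnWith
    ; D⇒G       = ConnWith⇒merged ∘ ConnWith-map D⇒G ∘ added⁻
    }
    where
    cv : IsPath G v (proj₁ (G-path v))
    cv = proj₂ (G-path v)
    cw : IsPath G w (proj₁ (G-path w))
    cw = proj₂ (G-path w)
    open Merge G-heap cv cw
    open AddsEdge (simMerge-addsEdge v∈H w∈H)

    paths≡L : path H v ++ path H w ≡ L
    paths≡L = cong₂ _++_ (path-H v∈H cv) (path-H w∈H cw)

    L-live : ∀ {t} → t ∈ L → t ∈ nodes H
    L-live t∈L with ∈-++⁻ (proj₁ (G-path v)) t∈L
    ... | inj₁ t∈Pv = G-path-live v∈H cv t∈Pv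
    ... | inj₂ t∈Pw = G-path-live w∈H cw t∈Pw

    agree : ∀ {z} → z ∈ nodes H → mergeParent (par H) L z ≡ merged z
    agree {z} z∈H with elem z L
    ... | true  = refl
    ... | false = H≗G z∈H

    merged-closed : Closed merged seen
    merged-closed {x} e with elem x L in x∈?L
    ... | true  = live⊆seen (L-live (elem-true⇒∈ x L x∈?L))
                , live⊆seen (L-live (proj₁ (largestBelow-sound L x e)))
    ... | false = G-closed e

    merged-live : ∀ {z u} → z ∈ nodes H → merged z ≡ just u → u ∈ nodes H
    merged-live {z} z∈H e with elem z L
    ... | true  = L-live (proj₁ (largestBelow-sound L z e))
    ... | false = G-live z∈H e

  insert-simulation : ∀ {v} → v ∉ seen → Simulation (v ∷ seen) (insertH H v) (maketree D v)
  insert-simulation {v} v∉seen = record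
    { G         = G
    ; G-heap    = G-heap
    ; G-closed  = λ e → let x∈ , y∈ = G-closed e in there x∈ , there y∈
    ; H≗G       = agree
    ; G-live    = live
    ; live⊆seen = λ { (here refl) → here refl ; (there z∈H) → there (live⊆seen z∈H) }
    ; dead-root = λ z∉ → trans (update-≢ (par H) v nothing (λ { refl → z∉ (here refl) }))
                               (dead-root (z∉ ∘ there))
    ; D-nodes   = cong (v ∷_) D-nodes
    ; D-closed  = λ e → let x∈ , y∈ = D-closed (trans (sym (D≗ _)) e) in there x∈ , there y∈
    ; D-rooted  = Rooted-≗ (sym ∘ D≗) ∘ D-rooted
    ; G⇒D       = Conn-≗ (sym ∘ D≗) ∘ G⇒D
    ; D⇒G       = D⇒G ∘ Conn-≗ D≗
    }
    where
    D≗ : update (par D) v nothing ≗ par D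
    D≗ = update-nothing-≗ (closed-∉ D-closed v∉seen)

    agree : ∀ {z} → z ∈ v ∷ nodes H → update (par H) v nothing z ≡ G z
    agree (here refl) = trans (update-≡ (par H) v nothing) (sym (closed-∉ G-closed v∉seen))
    agree (there z∈H) =
      trans (update-≢ (par H) v nothing (λ { refl → v∉seen (live⊆seen z∈H) })) (H≗G z∈H)

    live : ∀ {z u} → z ∈ v ∷ nodes H → G z ≡ just u → u ∈ v ∷ nodes H
    live (here refl) e with () ← trans (sym (closed-∉ G-closed v∉seen)) e
    live (there z∈H) e = there (G-live z∈H e)

  delete-simulation : ∀ {x} → All (λ u → par H u ≢ just x) (nodes H) → Simulation seen (deleteH H x) D
  delete-simulation {x} leaf = record
    { G         = G
    ; G-heap    = G-heap
    ; G-closed  = G-closed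
    ; H≗G       = λ z∈ → let z∈H , z≢x = ∈-remove⁻ x (nodes H) z∈ in
                         trans (update-≢ (par H) x nothing z≢x) (H≗G z∈H)
    ; G-live    = live
    ; live⊆seen = live⊆seen ∘ proj₁ ∘ ∈-remove⁻ x (nodes H)
    ; dead-root = dead
    ; D-nodes   = D-nodes
    ; D-closed  = D-closed
    ; D-rooted  = D-rooted
    ; G⇒D       = G⇒D
    ; D⇒G       = D⇒G
    }
    where
    live : ∀ {z u} → z ∈ remove x (nodes H) → G z ≡ just u → u ∈ remove x (nodes H)
    live z∈ e with ∈-remove⁻ x (nodes H) z∈
    ... | z∈H , _ =
      ∈-remove⁺ x (nodes H) (G-live z∈H e) (λ { refl → All.lookup leaf z∈H (trans (H≗G z∈H) e) })

    dead : ∀ {z} → z ∉ remove x (nodes H) → update (par H) x nothing z ≡ nothing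
    dead {z} z∉ with z ≟ x
    ... | yes refl = update-≡ (par H) x nothing
    ... | no  z≢x  =
      trans (update-≢ (par H) x nothing z≢x) (dead-root (z∉ ∘ λ z∈H → ∈-remove⁺ x (nodes H) z∈H z≢x))

initial-simulation : Simulation [] emptyForest emptyForest
initial-simulation = record
  { G = λ _ → nothing ; G-heap = λ () ; G-closed = λ () ; H≗G = λ () ; G-live = λ ()
  ; live⊆seen = λ () ; dead-root = λ _ → refl ; D-nodes = refl ; D-closed = λ ()
  ; D-rooted = λ _ → done refl ; G⇒D = id ; D⇒G = id
  }

simulation-correct : ∀ {seen H D} ops → Simulation seen H D → Valid seen H ops →
                     runH H ops ≡ runD D ops
simulation-correct []                    S _                    = refl
simulation-correct (insert v ∷ ops)      S (v∉seen , valid)     =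
  simulation-correct ops (Simulated.insert-simulation S v∉seen) valid
simulation-correct (merge v w ∷ ops)     S (v∈H , w∈H , valid)  =
  simulation-correct ops (Simulated.merge-simulation S v∈H w∈H) valid
simulation-correct (rootQ v ∷ ops)       S (v∈H , valid)        =
  cong₂ _∷_ (cong just (Simulated.root-correct S v∈H)) (simulation-correct ops S valid)
simulation-correct {D = D} (ncaQ v w ∷ ops) S (v∈H , w∈H , valid)
  with simNca D v w | Simulated.nca-correct S v∈H w∈H
... | _ | D″ , refl , S″ = cong (_ ∷_) (simulation-correct ops S″ valid)
simulation-correct (deleteLeaf x ∷ ops)  S (_ , leaf , valid)   =
  simulation-correct ops (Simulated.delete-simulation S leaf) valid

theorem2 : (ops : List Op) → Valid [] emptyForest ops →
           runH emptyForest ops ≡ runD emptyForest ops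
theorem2 ops = simulation-correct ops initial-simulation
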